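{- Let $k$ be even, $1\le s\le k-1$, $m$ a positive integer, $n=m(k-s)\ge 2k-s$, and let $G$ be the $k$-uniform $s$-cycle with vertex set $\mathbb Z_n$ and edges $e_j=\{j(k-s)+1,\dots,j(k-s)+k\}$ (mod $n$), $j=0,\dots,m-1$. If $k=q(k-s)$ for an odd integer $q$, then $G$ is odd-bipartite.
   Context: A $k$-uniform hypergraph $G=(V,E)$ with $k$ even is odd-bipartite if either $E=\emptyset$ or there is a partition $V=V_1\cup V_2$ with $V_1,V_2\ne\emptyset$ such that every edge meets $V_1$ in an odd number of vertices. -}

module Defs where

open import Data.Nat using (ℕ; zero; suc; _+_; _*_; _∸_; NonZero; _%_)
open import Data.Nat.DivMod using (m%n<n)
open import Data.Fin using (Fin; fromℕ<)
open import Data.Fin.Subset using (Subset; ⊥; ⁅_⁆; _∪_; _∩_; ∁; ∣_∣; Nonempty)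
open import Data.List using (List; []; _∷_; map; upTo)
open import Data.List.Relation.Unary.All using (All)
open import Data.Product using (∃; _×_)
open import Data.Sum using (_⊎_)
open import Relation.Binary.PropositionalEquality using (_≡_)

record Hypergraph (n : ℕ) : Set where
  constructor hypergraph
  field
    edges : List (Subset n)

Odd : ℕ → Set
Odd a = ∃ λ t → a ≡ suc (2 * t)

Uniform : ∀ {n} → ℕ → Hypergraph n → Set
Uniform k G = All (λ e → ∣ e ∣ ≡ k) (Hypergraph.edges G)

-- Odd-bipartite (k even is a standing assumption of the notion):
-- either E = ∅, or there is a partition V = V₁ ∪ V₂ with V₁, V₂ nonempty
-- (V₂ = complement of V₁) such that every edge meets V₁ in an odd number of vertices.
OddBipartite : ∀ {n} → Hypergraph n → Set
OddBipartite {n} G =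
  Hypergraph.edges G ≡ []
  ⊎ ∃ λ (V₁ : Subset n) → Nonempty V₁ × Nonempty (∁ V₁)
      × All (λ e → Odd ∣ e ∩ V₁ ∣) (Hypergraph.edges G)

res : (n : ℕ) → .{{NonZero n}} → ℕ → Fin n
res n a = fromℕ< (m%n<n a n)

block : (n : ℕ) → .{{NonZero n}} → (base k : ℕ) → Subset n
block n base zero = ⊥
block n base (suc k) = ⁅ res n (base + suc k) ⁆ ∪ block n base k

sCycle : (k s m n : ℕ) → .{{NonZero n}} → Hypergraph n
sCycle k s m n = hypergraph (map (λ j → block n (j * (k ∸ s)) k) (upTo m))

-- The vertices divisible by d = k - s form the odd side.  Since k = q d with
-- q odd, every edge is a run of q d consecutive residues starting just after a
-- multiple of d, so it contains exactly q multiples of d; k < n keeps those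
-- residues distinct.  The case d = 1 cannot occur, as then k = q would be odd.
module Submission where

open import Defs
open import Data.Bool using (Bool; true; false; not; if_then_else_)
open import Data.Nat using (ℕ; zero; suc; _+_; _*_; _∸_; _≤_; _≥_; _<_; NonZero; >-nonZero; >-nonZero⁻¹; _%_; _/_; _≡ᵇ_; z≤n; s≤s)
open import Data.Nat.Properties
open import Data.Nat.DivMod using (m%n<n; m≡m%n+[m/n]*n; [m+kn]%n≡m%n; m*n%n≡0; m<n⇒m%n≡m; m∣n⇒o%n%m≡o%m)
open import Data.Nat.Divisibility using (_∣_; divides; ∣m+n∣m⇒∣n; ∣⇒≤)
open import Data.Fin using (Fin; zero; suc; toℕ)
open import Data.Fin.Properties using (toℕ-fromℕ<)
open import Data.Fin.Subset using (Subset; inside; outside; ⁅_⁆; _∪_; _∩_; ∁; ∣_∣; _∈_; _∉_)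
open import Data.Fin.Subset.Properties using (∉⊥; x∈⁅y⁆⇒x≡y; x∈p∪q⁻; ∪-identityˡ; ∩-zeroˡ; ∣⊥∣≡0)
open import Data.Vec using (_∷_; lookup; tabulate; here; there)
open import Data.Vec.Properties using (lookup∘tabulate; lookup⇒[]=; lookup-map)
open import Data.List using (map; upTo)
open import Data.List.Relation.Unary.All using (universal)
open import Data.List.Relation.Unary.All.Properties using (map⁺)
open import Data.Product using (∃; _×_; _,_)
open import Data.Sum using (inj₁; inj₂)
open import Function using (_∘_)
open import Relation.Nullary using (contradiction)
open import Relation.Binary.PropositionalEquality

indicator : Bool → ℕ
indicator b = if b then 1 else 0

-- The number of i ∈ {1, …, k} with P i; indices start at 1, as in block.
countUpTo : (ℕ → Bool) → ℕ → ℕ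
countUpTo P zero = 0
countUpTo P (suc k) = indicator (P (suc k)) + countUpTo P k

countUpTo-cong : ∀ {P Q : ℕ → Bool} → (∀ i → P i ≡ Q i) → ∀ k → countUpTo P k ≡ countUpTo Q k
countUpTo-cong P≗Q zero = refl
countUpTo-cong P≗Q (suc k) = cong₂ _+_ (cong indicator (P≗Q (suc k))) (countUpTo-cong P≗Q k)

divisibleBy : (d : ℕ) → .{{NonZero d}} → ℕ → Bool
divisibleBy d i = i % d ≡ᵇ 0

countUpTo-divisibleBy : ∀ d .{{_ : NonZero d}} t r → r < d → countUpTo (divisibleBy d) (t * d + r) ≡ t
countUpTo-divisibleBy d t (suc r) r<d = begin
  countUpTo (divisibleBy d) (t * d + suc r)    ≡⟨ cong (countUpTo (divisibleBy d)) (+-suc (t * d) r) ⟩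
  countUpTo (divisibleBy d) (suc (t * d + r))  ≡⟨ cong₂ _+_ (cong indicator nondivisible)
                                                          (countUpTo-divisibleBy d t r (<-trans (n<1+n r) r<d)) ⟩
  t                                            ∎
  where
  open ≡-Reasoning
  nondivisible : divisibleBy d (suc (t * d + r)) ≡ false
  nondivisible = cong (_≡ᵇ 0) (begin
    suc (t * d + r) % d  ≡⟨ cong (_% d) (trans (sym (+-suc (t * d) r)) (+-comm (t * d) (suc r))) ⟩
    (suc r + t * d) % d  ≡⟨ [m+kn]%n≡m%n (suc r) t d ⟩
    suc r % d            ≡⟨ m<n⇒m%n≡m r<d ⟩
    suc r                ∎)
countUpTo-divisibleBy d zero zero _ = refl
countUpTo-divisibleBy d@(suc e) (suc t) zero _ = begin
  countUpTo (divisibleBy d) (suc t * d + 0)     ≡⟨ cong (countUpTo (divisibleBy d)) (trans (+-identityʳ _) period) ⟩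
  countUpTo (divisibleBy d) (suc (t * d + e))   ≡⟨ cong₂ _+_ (cong indicator divisible) (countUpTo-divisibleBy d t e ≤-refl) ⟩
  suc t                                         ∎
  where
  open ≡-Reasoning
  period : suc t * d ≡ suc (t * d + e)
  period = cong suc (+-comm e (t * d))
  divisible : divisibleBy d (suc (t * d + e)) ≡ true
  divisible = cong (_≡ᵇ 0) (trans (cong (_% d) (sym period)) (m*n%n≡0 (suc t) d))

∣⁅x⁆∪p∩q∣ : ∀ {n} (x : Fin n) (p q : Subset n) → x ∉ p →
            ∣ (⁅ x ⁆ ∪ p) ∩ q ∣ ≡ indicator (lookup q x) + ∣ p ∩ q ∣
∣⁅x⁆∪p∩q∣ zero (inside ∷ p) q x∉p = contradiction here x∉p
∣⁅x⁆∪p∩q∣ zero (outside ∷ p) (inside ∷ q) _ = cong (λ r → suc ∣ r ∩ q ∣) (∪-identityˡ p)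
∣⁅x⁆∪p∩q∣ zero (outside ∷ p) (outside ∷ q) _ = cong (λ r → ∣ r ∩ q ∣) (∪-identityˡ p)
∣⁅x⁆∪p∩q∣ (suc x) (inside ∷ p) (inside ∷ q) x∉p =
  trans (cong suc (∣⁅x⁆∪p∩q∣ x p q (x∉p ∘ there))) (sym (+-suc _ _))
∣⁅x⁆∪p∩q∣ (suc x) (inside ∷ p) (outside ∷ q) x∉p = ∣⁅x⁆∪p∩q∣ x p q (x∉p ∘ there)
∣⁅x⁆∪p∩q∣ (suc x) (outside ∷ p) (inside ∷ q) x∉p = ∣⁅x⁆∪p∩q∣ x p q (x∉p ∘ there)
∣⁅x⁆∪p∩q∣ (suc x) (outside ∷ p) (outside ∷ q) x∉p = ∣⁅x⁆∪p∩q∣ x p q (x∉p ∘ there)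

[m+o]%n≢m%n : ∀ m {n o} .{{_ : NonZero n}} → 0 < o → o < n → (m + o) % n ≢ m % n
[m+o]%n≢m%n m {n} {o} 0<o o<n eq = <⇒≱ o<n (∣⇒≤ {n = o} ⦃ >-nonZero 0<o ⦄ n∣o)
  where
  open ≡-Reasoning
  quotients : m / n * n + o ≡ (m + o) / n * n
  quotients = +-cancelˡ-≡ (m % n) _ _ (begin
    m % n + (m / n * n + o)          ≡⟨ sym (+-assoc (m % n) _ o) ⟩
    m % n + m / n * n + o            ≡⟨ cong (_+ o) (sym (m≡m%n+[m/n]*n m n)) ⟩
    m + o                            ≡⟨ m≡m%n+[m/n]*n (m + o) n ⟩
    (m + o) % n + (m + o) / n * n    ≡⟨ cong (_+ (m + o) / n * n) eq ⟩
    m % n + (m + o) / n * n          ∎)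
  n∣o : n ∣ o
  n∣o = ∣m+n∣m⇒∣n (divides ((m + o) / n) quotients) (divides (m / n) refl)

res-≡⇒%-≡ : ∀ n .{{_ : NonZero n}} {a b} → res n a ≡ res n b → a % n ≡ b % n
res-≡⇒%-≡ n {a} {b} eq = trans (sym (toℕ-fromℕ< (m%n<n a n))) (trans (cong toℕ eq) (toℕ-fromℕ< (m%n<n b n)))

∈-block⁻ : ∀ n .{{_ : NonZero n}} base k {x} → x ∈ block n base k → ∃ λ i → i ≤ k × x ≡ res n (base + i)
∈-block⁻ n base zero x∈ = contradiction x∈ ∉⊥
∈-block⁻ n base (suc k) x∈ with x∈p∪q⁻ ⁅ res n (base + suc k) ⁆ (block n base k) x∈
... | inj₁ x∈⁅y⁆ = suc k , ≤-refl , x∈⁅y⁆⇒x≡y _ x∈⁅y⁆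
... | inj₂ x∈block with ∈-block⁻ n base k x∈block
...   | i , i≤k , x≡ = i , m≤n⇒m≤1+n i≤k , x≡

res∉block : ∀ n .{{_ : NonZero n}} base k → suc k < n → res n (base + suc k) ∉ block n base k
res∉block n base k 1+k<n x∈ with ∈-block⁻ n base k x∈
... | i , i≤k , x≡ =
  [m+o]%n≢m%n (base + i) (m<n⇒0<n∸m (s≤s i≤k)) (≤-<-trans (m∸n≤m (suc k) i) 1+k<n)
              (trans (cong (_% n) split) (res-≡⇒%-≡ n x≡))
  where
  split : base + i + (suc k ∸ i) ≡ base + suc k
  split = trans (+-assoc base i _) (cong (base +_) (m+[n∸m]≡n (m≤n⇒m≤1+n i≤k)))

∣block∩p∣ : ∀ n .{{_ : NonZero n}} base k (p : Subset n) → k < n →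
            ∣ block n base k ∩ p ∣ ≡ countUpTo (λ i → lookup p (res n (base + i))) k
∣block∩p∣ n base zero p _ = trans (cong ∣_∣ (∩-zeroˡ p)) (∣⊥∣≡0 n)
∣block∩p∣ n base (suc k) p 1+k<n =
  trans (∣⁅x⁆∪p∩q∣ _ _ p (res∉block n base k 1+k<n))
        (cong (indicator (lookup p (res n (base + suc k))) +_) (∣block∩p∣ n base k p (<-trans (n<1+n k) 1+k<n)))

multiplesOf : ∀ n d .{{_ : NonZero d}} → Subset n
multiplesOf n d = tabulate (λ x → divisibleBy d (toℕ x))

lookup-multiplesOf-res : ∀ n d .{{_ : NonZero n}} .{{_ : NonZero d}} x → d ∣ n →
                         lookup (multiplesOf n d) (res n x) ≡ divisibleBy d x
lookup-multiplesOf-res n d x d∣n = trans (lookup∘tabulate _ (res n x))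
  (cong (_≡ᵇ 0) (trans (cong (_% d) (toℕ-fromℕ< (m%n<n x n))) (m∣n⇒o%n%m≡o%m d n x d∣n)))

∣block∩multiplesOf∣ : ∀ n d .{{_ : NonZero n}} .{{_ : NonZero d}} j q → d ∣ n → q * d < n →
                      ∣ block n (j * d) (q * d) ∩ multiplesOf n d ∣ ≡ q
∣block∩multiplesOf∣ n d j q d∣n qd<n = begin
  ∣ block n (j * d) (q * d) ∩ multiplesOf n d ∣                          ≡⟨ ∣block∩p∣ n (j * d) (q * d) _ qd<n ⟩
  countUpTo (λ i → lookup (multiplesOf n d) (res n (j * d + i))) (q * d) ≡⟨ countUpTo-cong periodic (q * d) ⟩
  countUpTo (divisibleBy d) (q * d)                                      ≡⟨ cong (countUpTo (divisibleBy d)) (sym (+-identityʳ (q * d))) ⟩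
  countUpTo (divisibleBy d) (q * d + 0)                                  ≡⟨ countUpTo-divisibleBy d q 0 (>-nonZero⁻¹ d) ⟩
  q                                                                      ∎
  where
  open ≡-Reasoning
  periodic : ∀ i → lookup (multiplesOf n d) (res n (j * d + i)) ≡ divisibleBy d i
  periodic i = trans (lookup-multiplesOf-res n d (j * d + i) d∣n)
                     (cong (_≡ᵇ 0) (trans (cong (_% d) (+-comm (j * d) i)) ([m+kn]%n≡m%n i j d)))

oddBipartite-blocks : ∀ n .{{_ : NonZero n}} d k q m → 2 ≤ d → Odd q → k ≡ q * d → n ≡ m * d → k < n →
                      OddBipartite (hypergraph (map (λ j → block n (j * d) k) (upTo m)))
oddBipartite-blocks n d@(suc (suc _)) k q m (s≤s (s≤s z≤n)) odd-q refl n≡md qd<n =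
  inj₂ (multiplesOf n d , (res n 0 , 0∈V) , (res n 1 , 1∈∁V) , map⁺ (universal odd-edge (upTo m)))
  where
  d∣n : d ∣ n
  d∣n = divides m n≡md
  0∈V : res n 0 ∈ multiplesOf n d
  0∈V = lookup⇒[]= (res n 0) _ (lookup-multiplesOf-res n d 0 d∣n)
  1∈∁V : res n 1 ∈ ∁ (multiplesOf n d)
  1∈∁V = lookup⇒[]= (res n 1) _ (trans (lookup-map (res n 1) _ (multiplesOf n d))
                                       (cong not (lookup-multiplesOf-res n d 1 d∣n)))
  odd-edge : ∀ j → Odd ∣ block n (j * d) (q * d) ∩ multiplesOf n d ∣
  odd-edge j = subst Odd (sym (∣block∩multiplesOf∣ n d j q d∣n qd<n)) odd-q

m≤n∸1⇒m<n : ∀ {m n} → 0 < m → m ≤ n ∸ 1 → m < n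
m≤n∸1⇒m<n {n = suc _} _          m≤n = s≤s m≤n
m≤n∸1⇒m<n {n = zero}  (s≤s _)   ()

even≡odd*d⇒2≤d : ∀ {k q d} → (∃ λ r → k ≡ 2 * r) → Odd q → k ≡ q * d → 0 < d → 2 ≤ d
even≡odd*d⇒2≤d {d = suc (suc _)} _ _ _ _ = s≤s (s≤s z≤n)
even≡odd*d⇒2≤d {k} {q} {d = suc zero} (r , k≡2r) (t , q≡1+2t) k≡q*1 _ =
  contradiction (begin 2 * r ≡⟨ sym k≡2r ⟩ k ≡⟨ k≡q*1 ⟩ q * 1 ≡⟨ *-identityʳ q ⟩ q ≡⟨ q≡1+2t ⟩ suc (2 * t) ∎)
                (even≢odd r t)
  where open ≡-Reasoning

corollary4p1 : (k s m n : ℕ) → (∃ λ r → k ≡ 2 * r) → 1 ≤ s → s ≤ k ∸ 1 → 1 ≤ m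
    → n ≡ m * (k ∸ s) → n ≥ (2 * k) ∸ s → .{{_ : NonZero n}}
    → (∃ λ q → Odd q × k ≡ q * (k ∸ s))
    → OddBipartite (sCycle k s m n)
corollary4p1 k s m n even-k 1≤s s≤k∸1 _ n≡md n≥2k∸s (q , odd-q , k≡qd) =
  oddBipartite-blocks n (k ∸ s) k q m (even≡odd*d⇒2≤d even-k odd-q k≡qd 0<d) odd-q k≡qd n≡md k<n
  where
  s<k : s < k
  s<k = m≤n∸1⇒m<n 1≤s s≤k∸1
  0<d : 0 < k ∸ s
  0<d = m<n⇒0<n∸m s<k
  k<n : k < n
  k<n = begin-strict
    k            <⟨ m<m+n k 0<d ⟩
    k + (k ∸ s)  ≡⟨ sym (+-∸-assoc k (<⇒≤ s<k)) ⟩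
    k + k ∸ s    ≡⟨ cong (λ x → k + x ∸ s) (sym (+-identityʳ k)) ⟩
    2 * k ∸ s    ≤⟨ n≥2k∸s ⟩
    n            ∎
    where open ≤-Reasoning
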